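{- Let $G_1=(V_1,E_1)$ be a graph with $G_1=EI(\mathcal{H}_1)$ for some 3-uniform hypergraph $\mathcal{H}_1=(V_1,\mathcal{E}_1)$, let $v\in V_1$ with $d_{G_1}(v)\ge 1$, and let $C_n=(V_2,E_2)$ be a cycle of length $n\ge 3$ with $V_1\cap V_2=\{v\}$. Suppose moreover that if $n=4$ then $|V_1|\ge 5$. Then the 1-fusion $G_1\oplus C_n=(V_1\cup V_2,\,E_1\cup E_2)$ is the edge intersection hypergraph of some 3-uniform hypergraph.
   Context: All graphs and hypergraphs are finite, may have isolated vertices, and have no loops or multiple edges. A hypergraph is 3-uniform if every hyperedge has exactly 3 vertices. The edge intersection hypergraph of $\mathcal{H}=(V,\mathcal{E})$ is $EI(\mathcal{H})=(V,\mathcal{E}^{EI})$ with $\mathcal{E}^{EI}=\{e_1\cap e_2 : e_1,e_2\in\mathcal{E},\ e_1\neq e_2,\ |e_1\cap e_2|\ge 2\}$; it has the same vertex set as $\mathcal{H}$, and when it is 2-uniform it is regarded as a simple graph; "$G=EI(\mathcal{H})$" means equality of vertex sets and edge sets. For two graphs sharing exactly one vertex, their 1-fusion is simply their union (vertex sets and edge sets united). $d_{G_1}(v)$ denotes the degree of $v$ in $G_1$. -}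

module Defs where

open import Data.Nat using (ℕ; zero; suc; _≤_)
open import Data.Nat.DivMod using (_mod_)
open import Data.Fin using (Fin; toℕ)
open import Data.List using (List; []; _∷_; _++_; length)
open import Data.List.Membership.Propositional using (_∈_)
open import Data.List.Relation.Unary.Unique.Propositional using (Unique)
open import Data.Product using (_×_; _,_; ∃; ∃-syntax)
open import Data.Sum using (_⊎_)
open import Relation.Nullary using (¬_)
open import Relation.Binary.PropositionalEquality using (_≡_; _≢_)
open import Function.Bundles using (_⇔_)
open import Function.Definitions using (Injective)

-- Vertices are natural numbers; a finite set of vertices is a list
-- (read as the set of its members; duplicates are irrelevant).

_⊆ₛ_ : List ℕ → List ℕ → Set
xs ⊆ₛ ys = ∀ {x} → x ∈ xs → x ∈ ys

_≐_ : List ℕ → List ℕ → Set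
xs ≐ ys = ∀ x → (x ∈ xs) ⇔ (x ∈ ys)

AtLeast : ℕ → List ℕ → Set
AtLeast k S = ∃[ xs ] (Unique xs × k ≤ length xs × xs ⊆ₛ S)

-- Graphs: a vertex set and a list of edges {a,b} (given as pairs).

record Graph : Set where
  constructor graph
  field
    V : List ℕ
    E : List (ℕ × ℕ)
open Graph public

WFGraph : Graph → Set
WFGraph G = ∀ {a b} → (a , b) ∈ E G → a ≢ b × a ∈ V G × b ∈ V G

Adj : Graph → ℕ → ℕ → Set
Adj G x y = ∃[ a ] ∃[ b ] ((a , b) ∈ E G × ((a ≡ x × b ≡ y) ⊎ (a ≡ y × b ≡ x)))

DegreePositive : Graph → ℕ → Set
DegreePositive G v = ∃[ y ] Adj G v y

IsEdgeSet : Graph → List ℕ → Set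
IsEdgeSet G S = ∃[ a ] ∃[ b ] ((a , b) ∈ E G × S ≐ (a ∷ b ∷ []))

record Hypergraph : Set where
  constructor hypergraph
  field
    HV : List ℕ
    HE : List (List ℕ)
open Hypergraph public

WFHypergraph : Hypergraph → Set
WFHypergraph H = ∀ {e} → e ∈ HE H → e ⊆ₛ HV H

ThreeUniform : Hypergraph → Set
ThreeUniform H = ∀ {e} → e ∈ HE H → Unique e × length e ≡ 3

IsEIEdge : Hypergraph → List ℕ → Set
IsEIEdge H S = ∃[ e₁ ] ∃[ e₂ ]
  ( e₁ ∈ HE H × e₂ ∈ HE H × ¬ (e₁ ≐ e₂)
  × (∀ z → (z ∈ S) ⇔ (z ∈ e₁ × z ∈ e₂))
  × AtLeast 2 S )

IsEI : Graph → Hypergraph → Set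
IsEI G H = (V G ≐ HV H) × (∀ S → IsEdgeSet G S ⇔ IsEIEdge H S)

IsEIof3Uniform : Graph → Set
IsEIof3Uniform G = ∃[ H ] (WFHypergraph H × ThreeUniform H × IsEI G H)

next : ∀ {n} → Fin n → Fin n
next {suc m} i = suc (toℕ i) mod suc m

IsCycle : ℕ → Graph → Set
IsCycle n G = ∃[ c ] (Injective _≡_ _≡_ c
  × (∀ x → (x ∈ V G) ⇔ (∃[ i ] c i ≡ x))
  × (∀ x y → Adj G x y ⇔ (∃[ i ] ((c i ≡ x × c (next {n} i) ≡ y) ⊎ (c i ≡ y × c (next {n} i) ≡ x)))))

fusion : Graph → Graph → Graph
fusion G₁ G₂ = graph (V G₁ ++ V G₂) (E G₁ ++ E G₂)

module Submission where

-- Adjoin to H₁ new triples inside V₁ ∪ V(C) such that two new triples meet in at least two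
-- vertices only along a cycle edge or an edge of G₁, a new triple meets V₁ in at most one vertex
-- or in an edge of G₁, and every cycle edge is the intersection of two new triples; then the edge
-- intersection graph of the enlarged hypergraph is G₁ ⊕ C.  For n ≥ 5 the triples
-- {c i, c (i+1), c (i+2)} work: consecutive ones share a cycle edge and any other two share at most
-- one vertex.  For n = 3 and n = 4 the triples also use a neighbour y of v and one, respectively
-- three, further vertices of V₁ (whence |V₁| ≥ 5 when n = 4); these two finite configurations are
-- checked by evaluating decision procedures on labelled vertices.

open import Defs
open import Data.Empty using (⊥-elim)
open import Data.Fin using (Fin; zero; suc; toℕ; fromℕ<; #_)
open import Data.Fin.Properties using (toℕ-fromℕ<; toℕ-injective; toℕ<n) renaming (_≟_ to _≟ᶠ_)
open import Data.List using (List; []; _∷_; _++_; [_]; length; map; allFin; lookup)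
open import Data.List.Properties using (≡-dec; length-map)
open import Data.List.Membership.Propositional using (_∈_; _∉_; find)
open import Data.List.Membership.Propositional.Properties using (∈-++⁻; ∈-++⁺ˡ; ∈-++⁺ʳ; ∈-map⁻; ∈-map⁺; ∈-allFin; ∈-lookup)
open import Data.List.Relation.Binary.Subset.Propositional.Properties using (⊆-trans; ∷⁺ʳ; All-resp-⊇)
open import Data.List.Relation.Unary.All as All using (All; []; _∷_)
open import Data.List.Relation.Unary.AllPairs as AllPairs using ([]; _∷_)
open import Data.List.Relation.Unary.Any as Any using (Any; here; there)
open import Data.List.Relation.Unary.Unique.Propositional using (Unique)
import Data.List.Relation.Unary.Unique.Propositional.Properties as Unique
import Data.Nat as ℕ
open import Data.Nat using (ℕ; zero; suc; _+_; _*_; _∸_; _≤_; _<_; s≤s; z≤n; _%_; _/_; _≟_)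
open import Data.Nat.Properties
  using (≤-refl; ≤-reflexive; ≤-trans; ≤-<-trans; ≤-total; +-cancelˡ-≤; +-monoʳ-≤; m≤n+m; m≤m+n; n≤1+n; <⇒≤; <⇒≢; <⇒≱;
         +-comm; +-assoc; +-suc; +-identityʳ; +-cancelˡ-≡; m≤n⇒∃[o]m+o≡n; m+[n∸m]≡n)
open import Data.Nat.DivMod using (m%n%n≡m%n; %-distribˡ-+; m<n⇒m%n≡m; m≡m%n+[m/n]*n; [m+n]%n≡m%n; m%n<n)
open import Data.Product using (_×_; _,_; ∃-syntax; proj₁; proj₂; uncurry)
import Data.Product as Product
open import Data.Sum using (_⊎_; inj₁; inj₂)
import Data.Sum as Sum
open import Data.Sum.Properties using () renaming (≡-dec to ⊎-≡-dec)
open import Function using (_∘_; id)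
open import Function.Bundles using (_⇔_; mk⇔; Equivalence)
import Function.Properties.Equivalence as ⇔
open import Function.Definitions using (Injective)
open import Relation.Binary.Definitions using (DecidableEquality)
open import Relation.Binary.PropositionalEquality using (_≡_; _≢_; refl; sym; trans; cong; subst; subst₂; module ≡-Reasoning)
open import Relation.Nullary using (¬_; Dec; yes; no; ¬?; _×-dec_; _⊎-dec_; _→-dec_)
open import Relation.Nullary.Decidable using (from-yes)

open Equivalence using (to; from)

∈-pair⁻ : ∀ {A : Set} {z a b : A} → z ∈ a ∷ b ∷ [] → z ≡ a ⊎ z ≡ b
∈-pair⁻ (here z≡a) = inj₁ z≡a
∈-pair⁻ (there (here z≡b)) = inj₂ z≡b

∈-pair⁺ : ∀ {A : Set} {z a b : A} → z ≡ a ⊎ z ≡ b → z ∈ a ∷ b ∷ []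
∈-pair⁺ (inj₁ z≡a) = here z≡a
∈-pair⁺ (inj₂ z≡b) = there (here z≡b)

≐-refl : ∀ {S} → S ≐ S
≐-refl _ = ⇔.refl

≐-sym : ∀ {S T} → S ≐ T → T ≐ S
≐-sym S≐T z = ⇔.sym (S≐T z)

pair-swap : ∀ {a b} → (a ∷ b ∷ []) ≐ (b ∷ a ∷ [])
pair-swap _ = mk⇔ (∈-pair⁺ ∘ Sum.swap ∘ ∈-pair⁻) (∈-pair⁺ ∘ Sum.swap ∘ ∈-pair⁻)

_≐_∩_ : List ℕ → List ℕ → List ℕ → Set
S ≐ e ∩ f = ∀ z → (z ∈ S) ⇔ (z ∈ e × z ∈ f)

∩-comm : ∀ {S e f} → S ≐ e ∩ f → S ≐ f ∩ e
∩-comm S≐e∩f z = ⇔.trans (S≐e∩f z) (mk⇔ Product.swap Product.swap)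

pair-atLeast2 : ∀ {x y} → x ≢ y → AtLeast 2 (x ∷ y ∷ [])
pair-atLeast2 x≢y = _ , ((x≢y ∷ []) ∷ [] ∷ []) , ≤-refl , id

atLeast2⇒distinct : ∀ {S} → AtLeast 2 S → ∃[ x ] ∃[ y ] (x ≢ y × x ∈ S × y ∈ S)
atLeast2⇒distinct (x ∷ y ∷ _ , ((x≢y ∷ _) ∷ _) , _ , xs⊆S) = x , y , x≢y , xs⊆S (here refl) , xs⊆S (there (here refl))
atLeast2⇒distinct ([] , _ , () , _)
atLeast2⇒distinct (_ ∷ [] , _ , s≤s () , _)

atLeast2⇒¬singleton : ∀ {S u} → AtLeast 2 S → ¬ (∀ {z} → z ∈ S → z ≡ u)
atLeast2⇒¬singleton S≥2 S⊆u with atLeast2⇒distinct S≥2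
... | x , y , x≢y , x∈S , y∈S = x≢y (trans (S⊆u x∈S) (sym (S⊆u y∈S)))

atLeast2⇒≐pair : ∀ {S u w} → AtLeast 2 S → (∀ {z} → z ∈ S → z ≡ u ⊎ z ≡ w) → S ≐ (u ∷ w ∷ [])
atLeast2⇒≐pair {S} {u} {w} S≥2 S⊆uw z = mk⇔ (∈-pair⁺ ∘ S⊆uw) (pair⊆S ∘ ∈-pair⁻)
  where
  ends∈S : u ∈ S × w ∈ S
  ends∈S with atLeast2⇒distinct S≥2
  ... | x , y , x≢y , x∈S , y∈S with S⊆uw x∈S | S⊆uw y∈S
  ... | inj₁ refl | inj₂ refl = x∈S , y∈S
  ... | inj₂ refl | inj₁ refl = y∈S , x∈S
  ... | inj₁ refl | inj₁ refl = ⊥-elim (x≢y refl)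
  ... | inj₂ refl | inj₂ refl = ⊥-elim (x≢y refl)
  pair⊆S : z ≡ u ⊎ z ≡ w → z ∈ S
  pair⊆S (inj₁ refl) = proj₁ ends∈S
  pair⊆S (inj₂ refl) = proj₂ ends∈S

Adj⇒IsEdgeSet : ∀ {G x y S} → Adj G x y → S ≐ (x ∷ y ∷ []) → IsEdgeSet G S
Adj⇒IsEdgeSet (a , b , ab∈E , inj₁ (refl , refl)) S≐ = a , b , ab∈E , S≐
Adj⇒IsEdgeSet (a , b , ab∈E , inj₂ (refl , refl)) S≐ = a , b , ab∈E , λ z → ⇔.trans (S≐ z) (pair-swap z)

IsEIEdge-resp-≐ : ∀ {H S T} → S ≐ T → IsEIEdge H T → IsEIEdge H S
IsEIEdge-resp-≐ S≐T (e₁ , e₂ , e₁∈ , e₂∈ , e₁≉e₂ , T≐ , (xs , xs-unique , 2≤ , xs⊆T)) =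
  e₁ , e₂ , e₁∈ , e₂∈ , e₁≉e₂ , (λ z → ⇔.trans (S≐T z) (T≐ z)) , (xs , xs-unique , 2≤ , from (S≐T _) ∘ xs⊆T)

module _ (G₁ : Graph) (H₁ : Hypergraph) (C : Graph) where

  record FusionTriples (N : List (List ℕ)) : Set where
    field
      within      : ∀ {e} → e ∈ N → e ⊆ₛ (V G₁ ++ V C)
      uniform     : ∀ {e} → e ∈ N → Unique e × length e ≡ 3
      old-meets   : ∀ {e f S} → e ∈ N → f ∈ HE H₁ → S ≐ e ∩ f → AtLeast 2 S → IsEdgeSet G₁ S
      new-meets   : ∀ {e f S} → e ∈ N → f ∈ N → ¬ (e ≐ f) → S ≐ e ∩ f → AtLeast 2 S → IsEdgeSet (fusion G₁ C) S
      cycle-edges : ∀ {a b} → (a , b) ∈ E C → IsEIEdge (hypergraph [] N) (a ∷ b ∷ [])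

  fusion-EI : WFHypergraph H₁ → ThreeUniform H₁ → IsEI G₁ H₁ → ∀ {N} → FusionTriples N → IsEIof3Uniform (fusion G₁ C)
  fusion-EI H₁-wf H₁-3 (V₁≐ , E₁⇔) {N} T = H , H-wf , H-3 , (λ _ → ⇔.refl) , λ S → mk⇔ (edge⇒meet S) (meet⇒edge S)
    where
    open FusionTriples T
    H : Hypergraph
    H = hypergraph (V G₁ ++ V C) (HE H₁ ++ N)

    H-wf : WFHypergraph H
    H-wf e∈ with ∈-++⁻ (HE H₁) e∈
    ... | inj₁ e∈H₁ = ∈-++⁺ˡ ∘ from (V₁≐ _) ∘ H₁-wf e∈H₁
    ... | inj₂ e∈N = within e∈N

    H-3 : ThreeUniform H
    H-3 e∈ with ∈-++⁻ (HE H₁) e∈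
    ... | inj₁ e∈H₁ = H₁-3 e∈H₁
    ... | inj₂ e∈N = uniform e∈N

    edge⇒meet : ∀ S → IsEdgeSet (fusion G₁ C) S → IsEIEdge H S
    edge⇒meet S (a , b , ab∈E , S≐) with ∈-++⁻ (E G₁) ab∈E
    ... | inj₁ ab∈E₁ with to (E₁⇔ S) (a , b , ab∈E₁ , S≐)
    ...   | e₁ , e₂ , e₁∈ , e₂∈ , rest = e₁ , e₂ , ∈-++⁺ˡ e₁∈ , ∈-++⁺ˡ e₂∈ , rest
    edge⇒meet S (a , b , ab∈E , S≐) | inj₂ ab∈EC with IsEIEdge-resp-≐ {hypergraph [] N} S≐ (cycle-edges ab∈EC)
    ...   | e₁ , e₂ , e₁∈ , e₂∈ , rest = e₁ , e₂ , ∈-++⁺ʳ (HE H₁) e₁∈ , ∈-++⁺ʳ (HE H₁) e₂∈ , rest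

    lift : ∀ {S} → IsEdgeSet G₁ S → IsEdgeSet (fusion G₁ C) S
    lift (a , b , ab∈E₁ , S≐) = a , b , ∈-++⁺ˡ ab∈E₁ , S≐

    meet⇒edge : ∀ S → IsEIEdge H S → IsEdgeSet (fusion G₁ C) S
    meet⇒edge S (e₁ , e₂ , e₁∈ , e₂∈ , e₁≉e₂ , S≐ , S≥2) with ∈-++⁻ (HE H₁) e₁∈ | ∈-++⁻ (HE H₁) e₂∈
    ... | inj₁ e₁∈H₁ | inj₁ e₂∈H₁ = lift (from (E₁⇔ S) (e₁ , e₂ , e₁∈H₁ , e₂∈H₁ , e₁≉e₂ , S≐ , S≥2))
    ... | inj₂ e₁∈N  | inj₁ e₂∈H₁ = lift (old-meets e₁∈N e₂∈H₁ S≐ S≥2)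
    ... | inj₁ e₁∈H₁ | inj₂ e₂∈N  = lift (old-meets e₂∈N e₁∈H₁ (∩-comm S≐) S≥2)
    ... | inj₂ e₁∈N  | inj₂ e₂∈N  = new-meets e₁∈N e₂∈N e₁≉e₂ S≐ S≥2

module Rotation (m : ℕ) where
  open ≡-Reasoning

  rotate : ℕ → Fin (suc m) → Fin (suc m)
  rotate zero    i = i
  rotate (suc k) i = next (rotate k i)

  [a+b%n]%n≡[a+b]%n : ∀ a b → (a + b % suc m) % suc m ≡ (a + b) % suc m
  [a+b%n]%n≡[a+b]%n a b = begin
    (a + b % suc m) % suc m                   ≡⟨ %-distribˡ-+ a (b % suc m) (suc m) ⟩
    (a % suc m + b % suc m % suc m) % suc m   ≡⟨ cong (λ t → (a % suc m + t) % suc m) (m%n%n≡m%n b (suc m)) ⟩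
    (a % suc m + b % suc m) % suc m           ≡⟨ %-distribˡ-+ a b (suc m) ⟨
    (a + b) % suc m                           ∎

  toℕ-rotate : ∀ k i → toℕ (rotate k i) ≡ (toℕ i + k) % suc m
  toℕ-rotate zero i = begin
    toℕ i                  ≡⟨ m<n⇒m%n≡m (toℕ<n i) ⟨
    toℕ i % suc m          ≡⟨ cong (_% suc m) (+-identityʳ (toℕ i)) ⟨
    (toℕ i + 0) % suc m    ∎
  toℕ-rotate (suc k) i = begin
    toℕ (next (rotate k i))               ≡⟨ toℕ-fromℕ< _ ⟩
    suc (toℕ (rotate k i)) % suc m        ≡⟨ cong (λ t → suc t % suc m) (toℕ-rotate k i) ⟩
    (1 + (toℕ i + k) % suc m) % suc m     ≡⟨ [a+b%n]%n≡[a+b]%n 1 (toℕ i + k) ⟩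
    suc (toℕ i + k) % suc m               ≡⟨ cong (_% suc m) (+-suc (toℕ i) k) ⟨
    (toℕ i + suc k) % suc m               ∎

  rotate-+ : ∀ p q i → rotate (p + q) i ≡ rotate p (rotate q i)
  rotate-+ zero    q i = refl
  rotate-+ (suc p) q i = cong next (rotate-+ p q i)

  rotate-comm : ∀ p q i → rotate p (rotate q i) ≡ rotate q (rotate p i)
  rotate-comm p q i = begin
    rotate p (rotate q i)   ≡⟨ rotate-+ p q i ⟨
    rotate (p + q) i        ≡⟨ cong (λ k → rotate k i) (+-comm p q) ⟩
    rotate (q + p) i        ≡⟨ rotate-+ q p i ⟩
    rotate q (rotate p i)   ∎

  [i+n]%n≡i : ∀ i → (toℕ i + suc m) % suc m ≡ toℕ i
  [i+n]%n≡i i = trans ([m+n]%n≡m%n (toℕ i) (suc m)) (m<n⇒m%n≡m (toℕ<n i))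

  rotate-period : ∀ i → rotate (suc m) i ≡ i
  rotate-period i = toℕ-injective (begin
    toℕ (rotate (suc m) i)       ≡⟨ toℕ-rotate (suc m) i ⟩
    (toℕ i + suc m) % suc m      ≡⟨ [i+n]%n≡i i ⟩
    toℕ i                        ∎)

  next-injective : Injective _≡_ _≡_ (next {suc m})
  next-injective {i} {j} next-i≡next-j = begin
    i                    ≡⟨ rotate-period i ⟨
    next (rotate m i)    ≡⟨ rotate-comm 1 m i ⟩
    rotate m (next i)    ≡⟨ cong (rotate m) next-i≡next-j ⟩
    rotate m (next j)    ≡⟨ rotate-comm m 1 j ⟩
    next (rotate m j)    ≡⟨ rotate-period j ⟩
    j                    ∎

  rotate-injective : ∀ k → Injective _≡_ _≡_ (rotate k)
  rotate-injective zero    = id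
  rotate-injective (suc k) = rotate-injective k ∘ next-injective

  rotate-no-fixpoint : ∀ {d} i → 0 < d → d < suc m → rotate d i ≢ i
  rotate-no-fixpoint {d} i 0<d d<n rotate-d-i≡i = d≢multiple (a / suc m) d≡
    where
    a = toℕ i + d
    a%n≡i : a % suc m ≡ toℕ i
    a%n≡i = trans (sym (toℕ-rotate d i)) (cong toℕ rotate-d-i≡i)
    d≡ : d ≡ (a / suc m) * suc m
    d≡ = +-cancelˡ-≡ (toℕ i) d _ (trans (m≡m%n+[m/n]*n a (suc m)) (cong (_+ (a / suc m) * suc m) a%n≡i))
    d≢multiple : ∀ q → d ≢ q * suc m
    d≢multiple zero    d≡0 = <⇒≢ 0<d (sym d≡0)
    d≢multiple (suc q) d≡ = <⇒≱ d<n (subst (suc m ≤_) (sym d≡) (m≤m+n (suc m) (q * suc m)))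

  rotate-cancel-≤ : ∀ {p q} i → p ≤ q → q < suc m → rotate p i ≡ rotate q i → p ≡ q
  rotate-cancel-≤ {p} i p≤q q<n rotate-p≡rotate-q with m≤n⇒∃[o]m+o≡n p≤q
  ... | zero  , refl = sym (+-identityʳ p)
  ... | suc d , refl = ⊥-elim (rotate-no-fixpoint (rotate p i) (s≤s z≤n) (≤-<-trans (m≤n+m (suc d) p) q<n) (sym (begin
    rotate p i                     ≡⟨ rotate-p≡rotate-q ⟩
    rotate (p + suc d) i           ≡⟨ cong (λ k → rotate k i) (+-comm p (suc d)) ⟩
    rotate (suc d + p) i           ≡⟨ rotate-+ (suc d) p i ⟩
    rotate (suc d) (rotate p i)    ∎)))

  rotate-cancel : ∀ {p q} i → p < suc m → q < suc m → rotate p i ≡ rotate q i → p ≡ q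
  rotate-cancel {p} {q} i p<n q<n eq with ≤-total p q
  ... | inj₁ p≤q = rotate-cancel-≤ i p≤q q<n eq
  ... | inj₂ q≤p = sym (rotate-cancel-≤ i q≤p p<n (sym eq))

  shared⇒rotated : ∀ {a b} i j → b ≤ a → rotate a i ≡ rotate b j → ∃[ d ] (d ≤ a × rotate d i ≡ j)
  shared⇒rotated {b = b} i j b≤a eq with m≤n⇒∃[o]m+o≡n b≤a
  ... | d , refl = d , m≤n+m d b , rotate-injective b (trans (sym (rotate-+ b d i)) eq)

  rotate-reaches : ∀ i j → ∃[ k ] (k < suc m × rotate k i ≡ j)
  rotate-reaches i j = k , m%n<n (suc m ∸ toℕ i + toℕ j) (suc m) , toℕ-injective (begin
    toℕ (rotate k i)                           ≡⟨ toℕ-rotate k i ⟩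
    (toℕ i + k) % suc m                        ≡⟨ [a+b%n]%n≡[a+b]%n (toℕ i) (suc m ∸ toℕ i + toℕ j) ⟩
    (toℕ i + (suc m ∸ toℕ i + toℕ j)) % suc m  ≡⟨ cong (_% suc m) (+-assoc (toℕ i) (suc m ∸ toℕ i) (toℕ j)) ⟨
    (toℕ i + (suc m ∸ toℕ i) + toℕ j) % suc m  ≡⟨ cong (λ t → (t + toℕ j) % suc m) (m+[n∸m]≡n (<⇒≤ (toℕ<n i))) ⟩
    (suc m + toℕ j) % suc m                    ≡⟨ cong (_% suc m) (+-comm (suc m) (toℕ j)) ⟩
    (toℕ j + suc m) % suc m                    ≡⟨ [i+n]%n≡i j ⟩
    toℕ j                                      ∎)
    where
    k = (suc m ∸ toℕ i + toℕ j) % suc m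

  rotate-toℕ-next : ∀ k i → rotate (toℕ (next k)) i ≡ next (rotate (toℕ k) i)
  rotate-toℕ-next k i = toℕ-injective (begin
    toℕ (rotate (toℕ (next k)) i)                  ≡⟨ toℕ-rotate (toℕ (next k)) i ⟩
    (toℕ i + toℕ (next k)) % suc m                 ≡⟨ cong (λ t → (toℕ i + t) % suc m) (toℕ-fromℕ< (m%n<n (suc (toℕ k)) (suc m))) ⟩
    (toℕ i + suc (toℕ k) % suc m) % suc m          ≡⟨ [a+b%n]%n≡[a+b]%n (toℕ i) (suc (toℕ k)) ⟩
    (toℕ i + suc (toℕ k)) % suc m                  ≡⟨ toℕ-rotate (suc (toℕ k)) i ⟨
    toℕ (rotate (suc (toℕ k)) i)                   ∎)

lookup-injective : ∀ {A : Set} {xs : List A} → Unique xs → Injective _≡_ _≡_ (lookup xs)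
lookup-injective {xs = _ ∷ _} _            {zero}  {zero}  _  = refl
lookup-injective {xs = _ ∷ _} (x∉ ∷ _)     {zero}  {suc j} eq = ⊥-elim (All.lookup x∉ (∈-lookup j) eq)
lookup-injective {xs = _ ∷ _} (x∉ ∷ _)     {suc i} {zero}  eq = ⊥-elim (All.lookup x∉ (∈-lookup i) (sym eq))
lookup-injective {xs = _ ∷ _} (_ ∷ unique) {suc i} {suc j} eq = cong suc (lookup-injective unique eq)

module Labels {L : Set} (_≟_ : DecidableEquality L) where
  open import Data.List.Membership.DecPropositional _≟_ using (_∈?_)
  open import Data.List.Relation.Unary.Unique.DecPropositional _≟_ using (unique?)

  _∩_⊆_ : List L → List L → List L → Set
  e ∩ f ⊆ us = All (λ l → l ∈ f → l ∈ us) e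

  _∩_⊆?_ : ∀ e f us → Dec (e ∩ f ⊆ us)
  e ∩ f ⊆? us = All.all? (λ l → l ∈? f →-dec l ∈? us) e

  AllowedMeet : List (L × L) → List L → List L → Set
  AllowedMeet es e f = Any (λ u → e ∩ f ⊆ [ u ]) e ⊎ Any (λ (u , w) → e ∩ f ⊆ (u ∷ w ∷ [])) es

  allowedMeet? : ∀ es e f → Dec (AllowedMeet es e f)
  allowedMeet? es e f = Any.any? (λ u → e ∩ f ⊆? [ u ]) e ⊎-dec Any.any? (λ (u , w) → e ∩ f ⊆? (u ∷ w ∷ [])) es

  MeetsExactly : List L → List L → L → L → Set
  MeetsExactly e f u w = All (λ l → l ∈ e × l ∈ f) (u ∷ w ∷ []) × e ∩ f ⊆ (u ∷ w ∷ []) × u ≢ w × Any (_∉ f) e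

  meetsExactly? : ∀ e f u w → Dec (MeetsExactly e f u w)
  meetsExactly? e f u w = All.all? (λ l → l ∈? e ×-dec l ∈? f) (u ∷ w ∷ []) ×-dec e ∩ f ⊆? (u ∷ w ∷ [])
                          ×-dec ¬? (u ≟ w) ×-dec Any.any? (λ l → ¬? (l ∈? f)) e

  Valid : List L → List (L × L) → List (L × L) → List (List L) → Set
  Valid old old-edges cycle-pairs N =
      All (λ e → Unique e × length e ≡ 3) N
    × All (λ e → AllowedMeet old-edges e old) N
    × All (λ e → All (λ f → e ≡ f ⊎ AllowedMeet (old-edges ++ cycle-pairs) e f) N) N
    × All (λ (u , w) → Any (λ e → Any (λ f → MeetsExactly e f u w) N) N) cycle-pairs

  valid? : ∀ old old-edges cycle-pairs N → Dec (Valid old old-edges cycle-pairs N)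
  valid? old old-edges cycle-pairs N =
        All.all? (λ e → unique? e ×-dec length e ℕ.≟ 3) N
    ×-dec All.all? (λ e → allowedMeet? old-edges e old) N
    ×-dec All.all? (λ e → All.all? (λ f → ≡-dec _≟_ e f ⊎-dec allowedMeet? (old-edges ++ cycle-pairs) e f) N) N
    ×-dec All.all? (λ (u , w) → Any.any? (λ e → Any.any? (λ f → meetsExactly? e f u w) N) N) cycle-pairs

record CycleAttachment (G₁ : Graph) (H₁ : Hypergraph) (m : ℕ) (C : Graph) : Set where
  field
    H₁-wf       : WFHypergraph H₁
    H₁-3        : ThreeUniform H₁
    H₁-EI       : IsEI G₁ H₁
    c           : Fin (suc m) → ℕ
    c-injective : Injective _≡_ _≡_ c
    V-C         : ∀ x → (x ∈ V C) ⇔ (∃[ i ] c i ≡ x)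
    Adj-C       : ∀ x y → Adj C x y ⇔ (∃[ i ] ((c i ≡ x × c (next {suc m} i) ≡ y) ⊎ (c i ≡ y × c (next {suc m} i) ≡ x)))
    i₀          : Fin (suc m)
    V₁∩V-C      : ∀ x → (x ∈ V G₁ × x ∈ V C) ⇔ (x ≡ c i₀)

module Attached {G₁ : Graph} {H₁ : Hypergraph} {m : ℕ} {C : Graph} (A : CycleAttachment G₁ H₁ m C) where
  open CycleAttachment A public
  open Rotation m public

  c∈V-C : ∀ i → c i ∈ V C
  c∈V-C i = from (V-C (c i)) (i , refl)

  c∈V₁⇒≡i₀ : ∀ {i} → c i ∈ V G₁ → i ≡ i₀
  c∈V₁⇒≡i₀ c-i∈V₁ = c-injective (to (V₁∩V-C _) (c-i∈V₁ , c∈V-C _))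

  ∈H₁⇒∈V₁ : ∀ {f z} → f ∈ HE H₁ → z ∈ f → z ∈ V G₁
  ∈H₁⇒∈V₁ f∈H₁ z∈f = from (proj₁ H₁-EI _) (H₁-wf f∈H₁ z∈f)

  Adj-lift : ∀ {x y} → Adj G₁ x y → Adj (fusion G₁ C) x y
  Adj-lift (a , b , ab∈E , ends) = a , b , ∈-++⁺ˡ ab∈E , ends

  Adj-next : ∀ i → Adj (fusion G₁ C) (c i) (c (next i))
  Adj-next i with from (Adj-C (c i) (c (next i))) (i , inj₁ (refl , refl))
  ... | a , b , ab∈E , ends = a , b , ∈-++⁺ʳ (E G₁) ab∈E , ends

  cycle-edges-from : ∀ {H} → (∀ i → IsEIEdge H (c i ∷ c (next i) ∷ [])) → ∀ {a b} → (a , b) ∈ E C → IsEIEdge H (a ∷ b ∷ [])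
  cycle-edges-from {H} meets ab∈E with to (Adj-C _ _) (_ , _ , ab∈E , inj₁ (refl , refl))
  ... | i , inj₁ (refl , refl) = meets i
  ... | i , inj₂ (refl , refl) = IsEIEdge-resp-≐ {H} pair-swap (meets i)

  attached-EI : ∀ {N} → FusionTriples G₁ H₁ C N → IsEIof3Uniform (fusion G₁ C)
  attached-EI = fusion-EI G₁ H₁ C H₁-wf H₁-3 H₁-EI

  module LongCycle (5≤n : 5 ≤ suc m) where

    small<n : ∀ {a} → a ≤ 4 → a < suc m
    small<n a≤4 = ≤-trans (s≤s a≤4) 5≤n

    triple : Fin (suc m) → List ℕ
    triple i = c i ∷ c (rotate 1 i) ∷ c (rotate 2 i) ∷ []

    triples : List (List ℕ)
    triples = map triple (allFin (suc m))

    ∈-triple⁻ : ∀ {z i} → z ∈ triple i → ∃[ a ] (a ≤ 2 × z ≡ c (rotate a i))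
    ∈-triple⁻ (here z≡)               = 0 , z≤n , z≡
    ∈-triple⁻ (there (here z≡))       = 1 , s≤s z≤n , z≡
    ∈-triple⁻ (there (there (here z≡))) = 2 , ≤-refl , z≡

    c-rotate-≢ : ∀ {d} i → 0 < d → d ≤ 4 → c (rotate d i) ≢ c i
    c-rotate-≢ i 0<d d≤4 = rotate-no-fixpoint i 0<d (small<n d≤4) ∘ c-injective

    triple-unique : ∀ i → Unique (triple i)
    triple-unique i = ((c-rotate-≢ i (s≤s z≤n) (s≤s z≤n) ∘ sym) ∷ (c-rotate-≢ i (s≤s z≤n) (s≤s (s≤s z≤n)) ∘ sym) ∷ [])
                    ∷ ((c-rotate-≢ (rotate 1 i) (s≤s z≤n) (s≤s z≤n) ∘ sym) ∷ [])
                    ∷ [] ∷ []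

    meet-next : ∀ {z i} → z ∈ triple i → z ∈ triple (rotate 1 i) → z ≡ c (rotate 1 i) ⊎ z ≡ c (rotate 2 i)
    meet-next {i = i} z∈i z∈i⁺ with ∈-triple⁻ z∈i | ∈-triple⁻ z∈i⁺
    ... | a , a≤2 , refl | b , b≤2 , z≡ =
      by-offset a≤2 (rotate-cancel i (small<n (≤-trans a≤2 (m≤m+n 2 2))) (small<n (s≤s (≤-trans b≤2 (n≤1+n 2))))
                       (c-injective (trans z≡ (cong c (rotate-comm b 1 i)))))
      where
      by-offset : ∀ {a b} → a ≤ 2 → a ≡ suc b → c (rotate a i) ≡ c (rotate 1 i) ⊎ c (rotate a i) ≡ c (rotate 2 i)
      by-offset {b = 0} _ refl = inj₁ refl
      by-offset {b = 1} _ refl = inj₂ refl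
      by-offset {b = suc (suc _)} (s≤s (s≤s ())) refl

    meet-next² : ∀ {z i} → z ∈ triple i → z ∈ triple (rotate 2 i) → z ≡ c (rotate 2 i)
    meet-next² {i = i} z∈i z∈i⁺⁺ with ∈-triple⁻ z∈i | ∈-triple⁻ z∈i⁺⁺
    ... | a , a≤2 , refl | b , b≤2 , z≡ =
      by-offset a≤2 (rotate-cancel i (small<n (≤-trans a≤2 (m≤m+n 2 2))) (small<n (+-monoʳ-≤ 2 b≤2))
                       (c-injective (trans z≡ (cong c (rotate-comm b 2 i)))))
      where
      by-offset : ∀ {a b} → a ≤ 2 → a ≡ suc (suc b) → c (rotate a i) ≡ c (rotate 2 i)
      by-offset {b = 0} _ refl = refl
      by-offset {b = suc _} (s≤s (s≤s ())) refl

    ∈-triples : ∀ i → triple i ∈ triples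
    ∈-triples i = ∈-map⁺ triple (∈-allFin i)

    ∈triples⇒∈V-C : ∀ {e z} → e ∈ triples → z ∈ e → z ∈ V C
    ∈triples⇒∈V-C e∈ z∈e with ∈-map⁻ triple e∈
    ... | i , _ , refl with ∈-triple⁻ z∈e
    ...   | _ , _ , refl = c∈V-C _

    rotated-meet : ∀ i {d S} → d ≤ 2 → ¬ (triple i ≐ triple (rotate d i)) → S ≐ triple i ∩ triple (rotate d i)
                 → AtLeast 2 S → IsEdgeSet (fusion G₁ C) S
    rotated-meet i {0} _ i≉i _ _ = ⊥-elim (i≉i ≐-refl)
    rotated-meet i {1} _ _ S≐ S≥2 = Adj⇒IsEdgeSet {fusion G₁ C} (Adj-next (rotate 1 i)) (atLeast2⇒≐pair S≥2 (uncurry meet-next ∘ to (S≐ _)))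
    rotated-meet i {2} _ _ S≐ S≥2 = ⊥-elim (atLeast2⇒¬singleton S≥2 (uncurry meet-next² ∘ to (S≐ _)))
    rotated-meet i {suc (suc (suc _))} (s≤s (s≤s ())) _ _ _

    shared-meet : ∀ i j {a b S} → a ≤ 2 → b ≤ 2 → rotate a i ≡ rotate b j → ¬ (triple i ≐ triple j)
                → S ≐ triple i ∩ triple j → AtLeast 2 S → IsEdgeSet (fusion G₁ C) S
    shared-meet i j {a} {b} a≤2 b≤2 shared i≉j S≐ S≥2 with ≤-total b a
    ... | inj₁ b≤a with shared⇒rotated i j b≤a shared
    ...   | d , d≤a , refl = rotated-meet i (≤-trans d≤a a≤2) i≉j S≐ S≥2
    shared-meet i j a≤2 b≤2 shared i≉j S≐ S≥2 | inj₂ a≤b with shared⇒rotated j i a≤b (sym shared)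
    ...   | d , d≤b , refl = rotated-meet j (≤-trans d≤b b≤2) (i≉j ∘ ≐-sym) (∩-comm S≐) S≥2

    new-meets : ∀ {e f S} → e ∈ triples → f ∈ triples → ¬ (e ≐ f) → S ≐ e ∩ f → AtLeast 2 S → IsEdgeSet (fusion G₁ C) S
    new-meets e∈ f∈ e≉f S≐ S≥2 with ∈-map⁻ triple e∈ | ∈-map⁻ triple f∈ | atLeast2⇒distinct S≥2
    ... | i , _ , refl | j , _ , refl | x , _ , _ , x∈S , _ with to (S≐ x) x∈S
    ... | x∈i , x∈j with ∈-triple⁻ x∈i | ∈-triple⁻ x∈j
    ... | a , a≤2 , refl | b , b≤2 , x≡ = shared-meet i j a≤2 b≤2 (c-injective x≡) e≉f S≐ S≥2

    consecutive-meet : ∀ i → IsEIEdge (hypergraph [] triples) (c (rotate 1 i) ∷ c (rotate 2 i) ∷ [])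
    consecutive-meet i = triple i , triple (rotate 1 i) , ∈-triples i , ∈-triples (rotate 1 i) , i≉i⁺ , meet ,
                         pair-atLeast2 (c-rotate-≢ (rotate 1 i) (s≤s z≤n) (s≤s z≤n) ∘ sym)
      where
      i≉i⁺ : ¬ (triple i ≐ triple (rotate 1 i))
      i≉i⁺ i≐i⁺ with meet-next (here refl) (to (i≐i⁺ (c i)) (here refl))
      ... | inj₁ c-i≡ = c-rotate-≢ i (s≤s z≤n) (s≤s z≤n) (sym c-i≡)
      ... | inj₂ c-i≡ = c-rotate-≢ i (s≤s z≤n) (s≤s (s≤s z≤n)) (sym c-i≡)
      meet : (c (rotate 1 i) ∷ c (rotate 2 i) ∷ []) ≐ triple i ∩ triple (rotate 1 i)
      meet z = mk⇔ pair⊆meet (∈-pair⁺ ∘ uncurry meet-next)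
        where
        pair⊆meet : z ∈ c (rotate 1 i) ∷ c (rotate 2 i) ∷ [] → z ∈ triple i × z ∈ triple (rotate 1 i)
        pair⊆meet (here refl)         = there (here refl) , here refl
        pair⊆meet (there (here refl)) = there (there (here refl)) , there (here refl)

    long-cycle-triples : FusionTriples G₁ H₁ C triples
    long-cycle-triples = record
      { within      = λ e∈ z∈e → ∈-++⁺ʳ (V G₁) (∈triples⇒∈V-C e∈ z∈e)
      ; uniform     = uniform
      ; old-meets   = λ e∈ f∈H₁ S≐ S≥2 → ⊥-elim (atLeast2⇒¬singleton S≥2 λ {z} z∈S →
                        to (V₁∩V-C z) (∈H₁⇒∈V₁ f∈H₁ (proj₂ (to (S≐ z) z∈S)) , ∈triples⇒∈V-C e∈ (proj₁ (to (S≐ z) z∈S))))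
      ; new-meets   = new-meets
      ; cycle-edges = cycle-edges-from {hypergraph [] triples} λ i →
                        subst (λ j → IsEIEdge (hypergraph [] triples) (c j ∷ c (next j) ∷ [])) (rotate-period i) (consecutive-meet (rotate m i))
      }
      where
      uniform : ∀ {e} → e ∈ triples → Unique e × length e ≡ 3
      uniform e∈ with ∈-map⁻ triple e∈
      ... | i , _ , refl = triple-unique i , refl

    long-cycle-EI : IsEIof3Uniform (fusion G₁ C)
    long-cycle-EI = attached-EI long-cycle-triples

  module Labelled
    {L : Set} (_≟_ : DecidableEquality L) (ι : L → ℕ) (ι-injective : Injective _≡_ _≡_ ι)
    (ι-within : ∀ l → ι l ∈ V G₁ ++ V C)
    (old : List L) (old-complete : ∀ l → ι l ∈ V G₁ → l ∈ old)
    (old-edges : List (L × L)) (old-adj : ∀ {u w} → (u , w) ∈ old-edges → Adj G₁ (ι u) (ι w))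
    (cycle-pairs : List (L × L)) (cycle-adj : ∀ {u w} → (u , w) ∈ cycle-pairs → Adj (fusion G₁ C) (ι u) (ι w))
    (cycle-pairs-cover : ∀ i → ∃[ u ] ∃[ w ] ((u , w) ∈ cycle-pairs × ι u ≡ c i × ι w ≡ c (next i)))
    where
    open Labels _≟_

    ⟦_⟧ : List L → List ℕ
    ⟦_⟧ = map ι

    ∈⟦⟧-both : ∀ {z e f} → z ∈ ⟦ e ⟧ → z ∈ ⟦ f ⟧ → ∃[ l ] (l ∈ e × l ∈ f × z ≡ ι l)
    ∈⟦⟧-both z∈e z∈f with ∈-map⁻ ι z∈e | ∈-map⁻ ι z∈f
    ... | l , l∈e , refl | _ , l′∈f , ι-l≡ι-l′ with ι-injective ι-l≡ι-l′
    ...   | refl = l , l∈e , l′∈f , refl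

    allowed⇒IsEdgeSet : ∀ {G es e f S} → (∀ {u w} → (u , w) ∈ es → Adj G (ι u) (ι w)) → AllowedMeet es e f
                      → (∀ {z} → z ∈ S → ∃[ l ] (l ∈ e × l ∈ f × z ≡ ι l)) → AtLeast 2 S → IsEdgeSet G S
    allowed⇒IsEdgeSet {S = S} _ (inj₁ single) S⊆ S≥2 with Any.satisfied single
    ... | u , e∩f⊆u = ⊥-elim (atLeast2⇒¬singleton S≥2 S⊆ι-u)
      where
      S⊆ι-u : ∀ {z} → z ∈ S → z ≡ ι u
      S⊆ι-u z∈S with S⊆ z∈S
      ... | l , l∈e , l∈f , refl with All.lookup e∩f⊆u l∈e l∈f
      ...   | here refl = refl
    allowed⇒IsEdgeSet {G} {S = S} adj (inj₂ pair) S⊆ S≥2 with find pair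
    ... | (u , w) , uw∈es , e∩f⊆uw = Adj⇒IsEdgeSet {G} (adj uw∈es) (atLeast2⇒≐pair S≥2 S⊆ι-uw)
      where
      S⊆ι-uw : ∀ {z} → z ∈ S → z ≡ ι u ⊎ z ≡ ι w
      S⊆ι-uw z∈S with S⊆ z∈S
      ... | l , l∈e , l∈f , refl = Sum.map (cong ι) (cong ι) (∈-pair⁻ (All.lookup e∩f⊆uw l∈e l∈f))

    exact-meet : ∀ {N u w} → Any (λ e → Any (λ f → MeetsExactly e f u w) N) N
               → IsEIEdge (hypergraph [] (map ⟦_⟧ N)) (ι u ∷ ι w ∷ [])
    exact-meet {N} {u} {w} covered with find covered
    ... | e , e∈N , covered-by-e with find covered-by-e
    ...   | f , f∈N , (ends , e∩f⊆uw , u≢w , e⊈f) =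
      ⟦ e ⟧ , ⟦ f ⟧ , ∈-map⁺ ⟦_⟧ e∈N , ∈-map⁺ ⟦_⟧ f∈N , distinct , meet , pair-atLeast2 (u≢w ∘ ι-injective)
      where
      distinct : ¬ (⟦ e ⟧ ≐ ⟦ f ⟧)
      distinct e≐f with find e⊈f
      ... | l , l∈e , l∉f with ∈-map⁻ ι (to (e≐f (ι l)) (∈-map⁺ ι l∈e))
      ...   | _ , l′∈f , ι-l≡ι-l′ with ι-injective ι-l≡ι-l′
      ...     | refl = l∉f l′∈f
      meet : (ι u ∷ ι w ∷ []) ≐ ⟦ e ⟧ ∩ ⟦ f ⟧
      meet z = mk⇔ end∈both (∈-pair⁺ ∘ both⇒end)
        where
        end∈both : z ∈ ι u ∷ ι w ∷ [] → z ∈ ⟦ e ⟧ × z ∈ ⟦ f ⟧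
        end∈both (here refl)         = Product.map (∈-map⁺ ι) (∈-map⁺ ι) (All.lookup ends (here refl))
        end∈both (there (here refl)) = Product.map (∈-map⁺ ι) (∈-map⁺ ι) (All.lookup ends (there (here refl)))
        both⇒end : z ∈ ⟦ e ⟧ × z ∈ ⟦ f ⟧ → z ≡ ι u ⊎ z ≡ ι w
        both⇒end (z∈e , z∈f) with ∈⟦⟧-both z∈e z∈f
        ... | l , l∈e , l∈f , refl = Sum.map (cong ι) (cong ι) (∈-pair⁻ (All.lookup e∩f⊆uw l∈e l∈f))

    labelled-EI : ∀ N → Valid old old-edges cycle-pairs N → IsEIof3Uniform (fusion G₁ C)
    labelled-EI N (N-triples , N-old-meets , N-new-meets , N-covers) = attached-EI (record
      { within      = within
      ; uniform     = uniform
      ; old-meets   = old-meets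
      ; new-meets   = new-meets
      ; cycle-edges = cycle-edges-from {hypergraph [] (map ⟦_⟧ N)} cycle-edge
      })
      where
      within : ∀ {e} → e ∈ map ⟦_⟧ N → e ⊆ₛ (V G₁ ++ V C)
      within e∈ z∈e with ∈-map⁻ ⟦_⟧ e∈
      ... | _ , _ , refl with ∈-map⁻ ι z∈e
      ...   | l , _ , refl = ι-within l

      uniform : ∀ {e} → e ∈ map ⟦_⟧ N → Unique e × length e ≡ 3
      uniform e∈ with ∈-map⁻ ⟦_⟧ e∈
      ... | e , e∈N , refl with All.lookup N-triples e∈N
      ...   | e-unique , |e|≡3 = Unique.map⁺ ι-injective e-unique , trans (length-map ι e) |e|≡3

      old-meets : ∀ {e f S} → e ∈ map ⟦_⟧ N → f ∈ HE H₁ → S ≐ e ∩ f → AtLeast 2 S → IsEdgeSet G₁ S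
      old-meets {S = S} e∈ f∈H₁ S≐ S≥2 with ∈-map⁻ ⟦_⟧ e∈
      ... | e , e∈N , refl = allowed⇒IsEdgeSet {G₁} old-adj (All.lookup N-old-meets e∈N) S⊆ S≥2
        where
        S⊆ : ∀ {z} → z ∈ S → ∃[ l ] (l ∈ e × l ∈ old × z ≡ ι l)
        S⊆ {z} z∈S with to (S≐ z) z∈S
        ... | z∈e , z∈f with ∈-map⁻ ι z∈e
        ...   | l , l∈e , refl = l , l∈e , old-complete l (∈H₁⇒∈V₁ f∈H₁ z∈f) , refl

      new-adj : ∀ {u w} → (u , w) ∈ old-edges ++ cycle-pairs → Adj (fusion G₁ C) (ι u) (ι w)
      new-adj uw∈ with ∈-++⁻ old-edges uw∈
      ... | inj₁ uw∈old = Adj-lift (old-adj uw∈old)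
      ... | inj₂ uw∈cycle = cycle-adj uw∈cycle

      new-meets : ∀ {e f S} → e ∈ map ⟦_⟧ N → f ∈ map ⟦_⟧ N → ¬ (e ≐ f) → S ≐ e ∩ f → AtLeast 2 S
                → IsEdgeSet (fusion G₁ C) S
      new-meets e∈ f∈ e≉f S≐ S≥2 with ∈-map⁻ ⟦_⟧ e∈ | ∈-map⁻ ⟦_⟧ f∈
      ... | e , e∈N , refl | f , f∈N , refl with All.lookup (All.lookup N-new-meets e∈N) f∈N
      ...   | inj₁ refl = ⊥-elim (e≉f ≐-refl)
      ...   | inj₂ allowed = allowed⇒IsEdgeSet {fusion G₁ C} new-adj allowed (λ z∈S → uncurry ∈⟦⟧-both (to (S≐ _) z∈S)) S≥2

      cycle-edge : ∀ i → IsEIEdge (hypergraph [] (map ⟦_⟧ N)) (c i ∷ c (next i) ∷ [])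
      cycle-edge i with cycle-pairs-cover i
      ... | u , w , uw∈ , ι-u≡ , ι-w≡ =
        subst₂ (λ a b → IsEIEdge (hypergraph [] (map ⟦_⟧ N)) (a ∷ b ∷ [])) ι-u≡ ι-w≡ (exact-meet (All.lookup N-covers uw∈))

  module SmallCycle
    (y : ℕ) (others : List ℕ) (v∷olds-unique : Unique (c i₀ ∷ y ∷ others))
    (y∈V₁ : y ∈ V G₁) (others⊆V₁ : others ⊆ₛ V G₁) (v~y : Adj G₁ (c i₀) y)
    where

    olds : List ℕ
    olds = y ∷ others

    olds⊆V₁ : olds ⊆ₛ V G₁
    olds⊆V₁ (here refl) = y∈V₁
    olds⊆V₁ (there z∈others) = others⊆V₁ z∈others

    Label : Set
    Label = Fin (length olds) ⊎ Fin (suc m)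

    _≟ˡ_ : DecidableEquality Label
    _≟ˡ_ = ⊎-≡-dec _≟ᶠ_ _≟ᶠ_

    -- v = c i₀ gets the cycle label inj₂ 0, not an inj₁ label.
    ι : Label → ℕ
    ι (inj₁ a) = lookup olds a
    ι (inj₂ k) = c (rotate (toℕ k) i₀)

    old≢cycle : ∀ a (k : Fin (suc m)) → lookup olds a ≢ c (rotate (toℕ k) i₀)
    old≢cycle a k eq = All.lookup (AllPairs.head v∷olds-unique) (∈-lookup a) (sym (trans eq (cong c (c∈V₁⇒≡i₀ cycle∈V₁))))
      where
      cycle∈V₁ : c (rotate (toℕ k) i₀) ∈ V G₁
      cycle∈V₁ = subst (_∈ V G₁) eq (olds⊆V₁ (∈-lookup a))

    ι-injective : Injective _≡_ _≡_ ι
    ι-injective {inj₁ a} {inj₁ b} eq  = cong inj₁ (lookup-injective (AllPairs.tail v∷olds-unique) eq)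
    ι-injective {inj₁ a} {inj₂ k} eq  = ⊥-elim (old≢cycle a k eq)
    ι-injective {inj₂ k} {inj₁ a} eq  = ⊥-elim (old≢cycle a k (sym eq))
    ι-injective {inj₂ k} {inj₂ k′} eq = cong inj₂ (toℕ-injective (rotate-cancel i₀ (toℕ<n k) (toℕ<n k′) (c-injective eq)))

    ι-within : ∀ l → ι l ∈ V G₁ ++ V C
    ι-within (inj₁ a) = ∈-++⁺ˡ (olds⊆V₁ (∈-lookup a))
    ι-within (inj₂ k) = ∈-++⁺ʳ (V G₁) (c∈V-C _)

    old : List Label
    old = inj₂ zero ∷ map inj₁ (allFin (length olds))

    old-complete : ∀ l → ι l ∈ V G₁ → l ∈ old
    old-complete (inj₁ a) _ = there (∈-map⁺ inj₁ (∈-allFin a))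
    old-complete (inj₂ k) ι-k∈V₁ = here (cong inj₂ (toℕ-injective k≡0))
      where
      k≡0 : toℕ k ≡ 0
      k≡0 = rotate-cancel i₀ (toℕ<n k) (s≤s z≤n) (c∈V₁⇒≡i₀ ι-k∈V₁)

    old-edges : List (Label × Label)
    old-edges = [ (inj₂ zero , inj₁ zero) ]

    old-adj : ∀ {u w} → (u , w) ∈ old-edges → Adj G₁ (ι u) (ι w)
    old-adj (here refl) = v~y

    cycle-pairs : List (Label × Label)
    cycle-pairs = map (λ k → inj₂ k , inj₂ (next k)) (allFin (suc m))

    cycle-adj : ∀ {u w} → (u , w) ∈ cycle-pairs → Adj (fusion G₁ C) (ι u) (ι w)
    cycle-adj uw∈ with ∈-map⁻ (λ k → inj₂ k , inj₂ (next k)) uw∈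
    ... | k , _ , refl = subst (Adj (fusion G₁ C) (ι (inj₂ k)) ∘ c) (sym (rotate-toℕ-next k i₀)) (Adj-next (rotate (toℕ k) i₀))

    cycle-pairs-cover : ∀ i → ∃[ u ] ∃[ w ] ((u , w) ∈ cycle-pairs × ι u ≡ c i × ι w ≡ c (next i))
    cycle-pairs-cover i with rotate-reaches i₀ i
    ... | k , k<n , rotate-k≡i = inj₂ (fromℕ< k<n) , inj₂ (next (fromℕ< k<n)) ,
          ∈-map⁺ (λ k → inj₂ k , inj₂ (next k)) (∈-allFin (fromℕ< k<n)) , cong c at-i ,
          cong c (trans (rotate-toℕ-next (fromℕ< k<n) i₀) (cong next at-i))
      where
      at-i : rotate (toℕ (fromℕ< k<n)) i₀ ≡ i
      at-i = trans (cong (λ t → rotate t i₀) (toℕ-fromℕ< k<n)) rotate-k≡i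

    open Labels _≟ˡ_ public using (Valid; valid?)

    small-cycle-EI : ∀ N → Valid old old-edges cycle-pairs N → IsEIof3Uniform (fusion G₁ C)
    small-cycle-EI = Labelled.labelled-EI _≟ˡ_ ι ι-injective ι-within old old-complete old-edges old-adj cycle-pairs cycle-adj cycle-pairs-cover

delete : ∀ (u : ℕ) {xs} → Unique xs → ∃[ ys ] (Unique ys × length xs ≤ suc (length ys) × ys ⊆ₛ xs × All (u ≢_) ys)
delete u {[]} [] = [] , [] , z≤n , id , []
delete u {x ∷ xs} (x∉xs ∷ xs-unique) with x ≟ u
... | yes refl = xs , xs-unique , ≤-refl , there , x∉xs
... | no x≢u with delete u xs-unique
...   | ys , ys-unique , |xs|≤ , ys⊆xs , u∉ys =
  x ∷ ys , (All-resp-⊇ ys⊆xs x∉xs ∷ ys-unique) , s≤s |xs|≤ , ∷⁺ʳ x ys⊆xs , (x≢u ∘ sym) ∷ u∉ys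

shorten : ∀ k {xs : List ℕ} → Unique xs → k ≤ length xs → ∃[ ys ] (length ys ≡ k × Unique ys × ys ⊆ₛ xs)
shorten zero    _                              _         = [] , refl , [] , λ ()
shorten (suc k) {x ∷ xs} (x∉xs ∷ xs-unique) (s≤s k≤|xs|) with shorten k xs-unique k≤|xs|
... | ys , refl , ys-unique , ys⊆xs = x ∷ ys , refl , (All-resp-⊇ ys⊆xs x∉xs ∷ ys-unique) , ∷⁺ʳ x ys⊆xs

fresh-vertices : ∀ {S v y} k → v ≢ y → AtLeast (2 + k) S → ∃[ ys ] (length ys ≡ k × Unique (v ∷ y ∷ ys) × ys ⊆ₛ S)
fresh-vertices {v = v} {y} k v≢y (xs , xs-unique , 2+k≤|xs| , xs⊆S) with delete v xs-unique
... | xs′ , xs′-unique , |xs|≤ , xs′⊆xs , v∉xs′ with delete y xs′-unique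
... | xs″ , xs″-unique , |xs′|≤ , xs″⊆xs′ , y∉xs″ with shorten k xs″-unique (+-cancelˡ-≤ 2 _ _ (≤-trans 2+k≤|xs| (≤-trans |xs|≤ (s≤s |xs′|≤))))
... | ys , |ys|≡k , ys-unique , ys⊆xs″ =
  ys , |ys|≡k , (v≢y ∷ All-resp-⊇ (⊆-trans ys⊆xs″ xs″⊆xs′) v∉xs′) ∷ All-resp-⊇ ys⊆xs″ y∉xs″ ∷ ys-unique ,
  ⊆-trans ys⊆xs″ (⊆-trans xs″⊆xs′ (⊆-trans xs′⊆xs xs⊆S))

Adj-ends : ∀ {G x y} → WFGraph G → Adj G x y → x ≢ y × y ∈ V G
Adj-ends G-wf (_ , _ , ab∈E , inj₁ (refl , refl)) = proj₁ (G-wf ab∈E) , proj₂ (proj₂ (G-wf ab∈E))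
Adj-ends G-wf (_ , _ , ab∈E , inj₂ (refl , refl)) = proj₁ (G-wf ab∈E) ∘ sym , proj₁ (proj₂ (G-wf ab∈E))

EI-edge⇒atLeast3 : ∀ {G H x y} → WFHypergraph H → ThreeUniform H → IsEI G H → Adj G x y → AtLeast 3 (V G)
EI-edge⇒atLeast3 {G} H-wf H-3 (V≐ , E⇔) x~y with to (E⇔ _) (Adj⇒IsEdgeSet {G} x~y ≐-refl)
... | e , _ , e∈H , _ = e , proj₁ (H-3 e∈H) , ≤-reflexive (sym (proj₂ (H-3 e∈H))) , from (V≐ _) ∘ H-wf e∈H

module _ {G₁ : Graph} {H₁ : Hypergraph} {C : Graph} where

  triangle-EI : (A : CycleAttachment G₁ H₁ 2 C) → let open CycleAttachment A in ∀ {y p}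
              → Unique (c i₀ ∷ y ∷ p ∷ []) → y ∈ V G₁ → (p ∷ []) ⊆ₛ V G₁ → Adj G₁ (c i₀) y → IsEIof3Uniform (fusion G₁ C)
  triangle-EI A {y} {p} unique y∈V₁ others⊆V₁ v~y = small-cycle-EI N (from-yes (valid? old old-edges cycle-pairs N))
    where
    open Attached A
    open SmallCycle y (p ∷ []) unique y∈V₁ others⊆V₁ v~y
    [v] [c₁] [c₂] [y] [p] : Label
    [v]  = inj₂ (# 0)
    [c₁] = inj₂ (# 1)
    [c₂] = inj₂ (# 2)
    [y]  = inj₁ (# 0)
    [p]  = inj₁ (# 1)
    N : List (List Label)
    N = ([v] ∷ [c₁] ∷ [c₂] ∷ []) ∷ ([c₁] ∷ [c₂] ∷ [p] ∷ []) ∷ ([v] ∷ [c₁] ∷ [y] ∷ []) ∷ ([v] ∷ [c₂] ∷ [y] ∷ []) ∷ []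

  square-EI : (A : CycleAttachment G₁ H₁ 3 C) → let open CycleAttachment A in ∀ {y z w w′}
            → Unique (c i₀ ∷ y ∷ z ∷ w ∷ w′ ∷ []) → y ∈ V G₁ → (z ∷ w ∷ w′ ∷ []) ⊆ₛ V G₁ → Adj G₁ (c i₀) y
            → IsEIof3Uniform (fusion G₁ C)
  square-EI A {y} {z} {w} {w′} unique y∈V₁ others⊆V₁ v~y = small-cycle-EI N (from-yes (valid? old old-edges cycle-pairs N))
    where
    open Attached A
    open SmallCycle y (z ∷ w ∷ w′ ∷ []) unique y∈V₁ others⊆V₁ v~y
    [v] [c₁] [c₂] [c₃] [y] [z] [w] [w′] : Label
    [v]  = inj₂ (# 0)
    [c₁] = inj₂ (# 1)
    [c₂] = inj₂ (# 2)
    [c₃] = inj₂ (# 3)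
    [y]  = inj₁ (# 0)
    [z]  = inj₁ (# 1)
    [w]  = inj₁ (# 2)
    [w′] = inj₁ (# 3)
    N : List (List Label)
    N = ([v] ∷ [c₁] ∷ [y] ∷ []) ∷ ([v] ∷ [c₃] ∷ [y] ∷ []) ∷ ([v] ∷ [c₁] ∷ [c₂] ∷ []) ∷ ([v] ∷ [c₁] ∷ [c₃] ∷ [])
      ∷ ([c₁] ∷ [c₂] ∷ [z] ∷ []) ∷ ([c₂] ∷ [c₃] ∷ [w] ∷ []) ∷ ([c₂] ∷ [c₃] ∷ [w′] ∷ []) ∷ []

  cycle-fusion-EI : ∀ m (A : CycleAttachment G₁ H₁ (2 + m) C) → let open CycleAttachment A in ∀ {y}
            → Adj G₁ (c i₀) y → c i₀ ≢ y × y ∈ V G₁ → (m ≡ 1 → AtLeast 5 (V G₁)) → IsEIof3Uniform (fusion G₁ C)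
  cycle-fusion-EI 0 A v~y (v≢y , y∈V₁) _
    with fresh-vertices 1 v≢y (EI-edge⇒atLeast3 (CycleAttachment.H₁-wf A) (CycleAttachment.H₁-3 A) (CycleAttachment.H₁-EI A) v~y)
  ... | _ ∷ [] , refl , unique , others⊆V₁ = triangle-EI A unique y∈V₁ others⊆V₁ v~y
  cycle-fusion-EI 1 A v~y (v≢y , y∈V₁) |V₁|≥5 with fresh-vertices 3 v≢y (|V₁|≥5 refl)
  ... | _ ∷ _ ∷ _ ∷ [] , refl , unique , others⊆V₁ = square-EI A unique y∈V₁ others⊆V₁ v~y
  cycle-fusion-EI (suc (suc _)) A _ _ _ = Attached.LongCycle.long-cycle-EI A (s≤s (s≤s (s≤s (s≤s (s≤s z≤n)))))

theorem5 : (G₁ : Graph) (H₁ : Hypergraph) → WFGraph G₁ → WFHypergraph H₁ → ThreeUniform H₁ → IsEI G₁ H₁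
           → (v : ℕ) → v ∈ V G₁ → DegreePositive G₁ v
           → (n : ℕ) → 3 ≤ n → (C : Graph) → IsCycle n C
           → (∀ x → (x ∈ V G₁ × x ∈ V C) ⇔ (x ≡ v))
           → (n ≡ 4 → AtLeast 5 (V G₁))
           → IsEIof3Uniform (fusion G₁ C)
theorem5 G₁ H₁ G₁-wf H₁-wf H₁-3 H₁-EI v _ (y , v~y) _ (s≤s (s≤s (s≤s {n = m} _))) C (c , c-injective , V-C , Adj-C) V₁∩V-C |V₁|≥5
  with to (V-C v) (proj₂ (from (V₁∩V-C v) refl))
... | i₀ , refl = cycle-fusion-EI m A v~y (Adj-ends G₁-wf v~y) (|V₁|≥5 ∘ cong (3 +_))
  where
  A : CycleAttachment G₁ H₁ (2 + m) C
  A = record { H₁-wf = H₁-wf ; H₁-3 = H₁-3 ; H₁-EI = H₁-EI ; c = c ; c-injective = c-injective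
             ; V-C = V-C ; Adj-C = Adj-C ; i₀ = i₀ ; V₁∩V-C = V₁∩V-C }
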